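{- Let $n>3$ be an integer such that $p=4n-1$ is prime. For integers $k$ put $\Gamma(k)=r_p((k-1)^2)+r_p(k+1-3n)$. Then \[\bigl|\{k\in\mathbb{Z} : 2\le k\le 4n-1,\ \Gamma(k)\ge p\}\bigr|=2n-2.\]
   Context: For a positive integer $q$ and $x\in\mathbb{Z}$, $r_q(x)\in\{0,1,\dots,q-1\}$ denotes the remainder of $x$ upon division by $q$. $\Gamma(k)$ is called the total residue of $k$, and $k$ is called a jump if $\Gamma(k)\ge p$. -}

module Defs where

open import Data.Nat as ℕ using (ℕ; NonZero; _≤_; _≤?_)
open import Data.Integer as ℤ using (ℤ; +_; _%ℕ_; _-_)
open import Data.List using (List; filter; length)
open import Data.List using (upTo)

r : (q : ℕ) .{{_ : NonZero q}} → ℤ → ℕ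
r q x = x %ℕ q

Γ : (p n : ℕ) .{{_ : NonZero p}} → ℤ → ℕ
Γ p n k = r p ((k - + 1) ℤ.* (k - + 1)) ℕ.+ r p (k ℤ.+ + 1 - + (3 ℕ.* n))

range : ℕ → ℕ → List ℕ
range lo hi = Data.List.map (lo ℕ.+_) (upTo (ℕ.suc hi ℕ.∸ lo))

jumpCount : (p n : ℕ) .{{_ : NonZero p}} → ℕ
jumpCount p n = length (filter (λ k → p ≤? Γ p n (+ k)) (range 2 (4 ℕ.* n ℕ.∸ 1)))

{-# OPTIONS --safe #-}
-- Write k = j + 1 with 0 ≤ j < p. As 4n ≡ 1 (mod p), k + 1 − 3n ≡ j + n + 1 and j² + j + n + 1 ≡ (j + 2n)² + 1,
-- so Γ(k) = r(j²) + r(j + n + 1) = r((j + 2n)² + 1) + p·[k is a jump].  Sum over the residues j < p.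
-- The terms r(j + n + 1) run through 0, …, p − 1 and add up to p(p − 1)/2.  Since p ≡ 3 (mod 4), −1 is not
-- a square mod p (by Fermat, y² ≡ −1 would give y ≡ y^p = y·(y²)^((p−1)/2) ≡ −y, so p ∣ y), hence
-- r(y² + 1) = r(y²) + 1 and the terms r((j + 2n)² + 1) add up to p + ∑ r(y²).  Therefore p·#jumps = p(p − 1)/2 − p,
-- i.e. there are (p − 3)/2 = 2n − 2 jumps, and j = 0 is not one of them.
module Submission where

open import Defs
open import Data.Nat using (ℕ; NonZero; _*_; _∸_; _<_)
open import Data.Nat.Primality using (Prime)
open import Relation.Binary.PropositionalEquality using (_≡_)

open import Data.Nat.Base using (zero; suc; _+_; _^_; _%_; _≤_; z≤n; s≤s; z<s; s≤s⁻¹)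
open import Data.Nat.Properties
open import Data.Nat.DivMod
open import Data.Nat.Divisibility using (_∣_; divides; _∣0; ∣m∣n⇒∣m+n; ∣m⇒∣m*n; >⇒∤; m%n≡0⇒n∣m; n∣m⇒m%n≡0)
open import Data.Nat.Combinatorics using (_C_; nCn≡1; nC1≡n; nCk+nC[k+1]≡[n+1]C[k+1]; k>n⇒nCk≡0)
open import Data.Nat.Primality using (euclidsLemma)
open import Data.Nat.Tactic.RingSolver using (solve-∀)
open import Data.Integer as ℤ using (_⊖_; _%ℕ_)
open import Data.Integer.Properties using ([+m]-[+n]≡m⊖n; ⊖-≥; ⊖-<)
open import Data.List.Base using (_∷_; length; filter; applyUpTo)
open import Data.List.Properties using (map-upTo)
open import Data.Bool.Base using (true; false; if_then_else_)
open import Data.Sum.Base using (inj₁; inj₂; [_,_]′)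
open import Relation.Nullary using (Dec; does; yes; no; ¬_; contradiction)
open import Relation.Unary using (Decidable)
open import Function.Base using (_∘_)
open import Relation.Binary.PropositionalEquality using (refl; sym; trans; cong; cong₂; subst; _≢_; module ≡-Reasoning)
open import Algebra.Properties.CommutativeSemigroup +-commutativeSemigroup
  using (interchange) renaming (x∙yz≈y∙xz to +-swap)
open import Algebra.Properties.CommutativeSemigroup *-commutativeSemigroup
  using () renaming (x∙yz≈y∙xz to *-swap)

open ≡-Reasoning

∑< : ℕ → (ℕ → ℕ) → ℕ
∑< zero    f = 0
∑< (suc n) f = ∑< n f + f n

syntax ∑< n (λ i → e) = ∑[ i < n ] e

∑-cong : ∀ {f g} n → (∀ i → i < n → f i ≡ g i) → ∑< n f ≡ ∑< n g
∑-cong zero    f≗g = refl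
∑-cong (suc n) f≗g = cong₂ _+_ (∑-cong n (λ i i<n → f≗g i (m<n⇒m<1+n i<n))) (f≗g n (n<1+n n))

∑-suc : ∀ f n → ∑< (suc n) f ≡ f 0 + ∑[ i < n ] f (suc i)
∑-suc f zero    = +-comm 0 (f 0)
∑-suc f (suc n) = trans (cong (_+ f (suc n)) (∑-suc f n)) (+-assoc (f 0) _ _)

∑-+ : ∀ f g n → ∑[ i < n ] (f i + g i) ≡ ∑< n f + ∑< n g
∑-+ f g zero    = refl
∑-+ f g (suc n) = trans (cong (_+ (f n + g n)) (∑-+ f g n)) (interchange (∑< n f) (∑< n g) (f n) (g n))

∑-*ˡ : ∀ c f n → ∑[ i < n ] (c * f i) ≡ c * ∑< n f
∑-*ˡ c f zero    = sym (*-zeroʳ c)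
∑-*ˡ c f (suc n) = trans (cong (_+ c * f n) (∑-*ˡ c f n)) (sym (*-distribˡ-+ c (∑< n f) (f n)))

∑-1 : ∀ n → ∑[ i < n ] 1 ≡ n
∑-1 zero    = refl
∑-1 (suc n) = trans (cong (_+ 1) (∑-1 n)) (+-comm n 1)

∑-∣ : ∀ {d f} n → (∀ i → i < n → d ∣ f i) → d ∣ ∑< n f
∑-∣ zero    d∣f = _ ∣0
∑-∣ (suc n) d∣f = ∣m∣n⇒∣m+n (∑-∣ n (λ i i<n → d∣f i (m<n⇒m<1+n i<n))) (d∣f n (n<1+n n))

2*∑-id : ∀ n → 2 * ∑[ i < suc n ] i ≡ suc n * n
2*∑-id zero    = refl
2*∑-id (suc n) = begin
  2 * (∑[ i < suc n ] i + suc n)     ≡⟨ *-distribˡ-+ 2 (∑[ i < suc n ] i) (suc n) ⟩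
  2 * ∑[ i < suc n ] i + 2 * suc n   ≡⟨ cong (_+ 2 * suc n) (2*∑-id n) ⟩
  suc n * n + 2 * suc n              ≡⟨ gauss-step n ⟩
  suc (suc n) * suc n                ∎
  where
  gauss-step : ∀ n → suc n * n + 2 * suc n ≡ suc (suc n) * suc n
  gauss-step = solve-∀

%-cong-+ : ∀ {a a′ b b′ d} .{{_ : NonZero d}} → a % d ≡ a′ % d → b % d ≡ b′ % d → (a + b) % d ≡ (a′ + b′) % d
%-cong-+ {a} {a′} {b} {b′} {d} a≡a′ b≡b′ = begin
  (a + b) % d              ≡⟨ %-distribˡ-+ a b d ⟩
  (a % d + b % d) % d      ≡⟨ cong₂ (λ x y → (x + y) % d) a≡a′ b≡b′ ⟩
  (a′ % d + b′ % d) % d    ≡⟨ %-distribˡ-+ a′ b′ d ⟨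
  (a′ + b′) % d            ∎

%-cong-* : ∀ {a a′ b b′ d} .{{_ : NonZero d}} → a % d ≡ a′ % d → b % d ≡ b′ % d → (a * b) % d ≡ (a′ * b′) % d
%-cong-* {a} {a′} {b} {b′} {d} a≡a′ b≡b′ = begin
  (a * b) % d              ≡⟨ %-distribˡ-* a b d ⟩
  (a % d * (b % d)) % d    ≡⟨ cong₂ (λ x y → (x * y) % d) a≡a′ b≡b′ ⟩
  (a′ % d * (b′ % d)) % d  ≡⟨ %-distribˡ-* a′ b′ d ⟨
  (a′ * b′) % d            ∎

%-cong-^ : ∀ {a b d} .{{_ : NonZero d}} k → a % d ≡ b % d → a ^ k % d ≡ b ^ k % d
%-cong-^ zero    a≡b = refl
%-cong-^ (suc k) a≡b = %-cong-* a≡b (%-cong-^ k a≡b)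

∑-rotate-suc : ∀ d .{{_ : NonZero d}} h → ∑[ j < d ] h (suc j % d) ≡ ∑< d h
∑-rotate-suc d@(suc q) h = begin
  ∑[ j < q ] h (suc j % d) + h (d % d)  ≡⟨ cong₂ _+_ (∑-cong q (λ j j<q → cong h (m<n⇒m%n≡m (s≤s j<q)))) (cong h (n%n≡0 d)) ⟩
  ∑[ j < q ] h (suc j) + h 0            ≡⟨ +-comm _ (h 0) ⟩
  h 0 + ∑[ j < q ] h (suc j)            ≡⟨ ∑-suc h q ⟨
  ∑< d h                                ∎

∑-rotate : ∀ d .{{_ : NonZero d}} g t → ∑[ j < d ] g ((j + t) % d) ≡ ∑< d g
∑-rotate d g zero    = ∑-cong d (λ j j<d → cong g (trans (cong (_% d) (+-identityʳ j)) (m<n⇒m%n≡m j<d)))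
∑-rotate d g (suc t) = begin
  ∑[ j < d ] g ((j + suc t) % d)        ≡⟨ ∑-cong d (λ j _ → cong g (shift j)) ⟩
  ∑[ j < d ] g ((suc j % d + t) % d)    ≡⟨ ∑-rotate-suc d (λ y → g ((y + t) % d)) ⟩
  ∑[ j < d ] g ((j + t) % d)            ≡⟨ ∑-rotate d g t ⟩
  ∑< d g                                ∎
  where
  shift : ∀ j → (j + suc t) % d ≡ (suc j % d + t) % d
  shift j = trans (cong (_% d) (+-suc j t)) (%-cong-+ {suc j} {suc j % d} {t} {t} (sym (m%n%n≡m%n (suc j) d)) refl)

𝟙 : ∀ {P : Set} → Dec P → ℕ
𝟙 P? = if does P? then 1 else 0

𝟙-false : ∀ {P : Set} (P? : Dec P) → ¬ P → 𝟙 P? ≡ 0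
𝟙-false (yes p) ¬p = contradiction p ¬p
𝟙-false (no _)  _  = refl

length-filter-applyUpTo : ∀ {P : ℕ → Set} (P? : Decidable P) f n →
                          length (filter P? (applyUpTo f n)) ≡ ∑[ i < n ] 𝟙 (P? (f i))
length-filter-applyUpTo P? f zero    = refl
length-filter-applyUpTo P? f (suc n) = begin
  length (filter P? (f 0 ∷ applyUpTo (f ∘ suc) n))            ≡⟨ length-filter-∷ (f 0) _ ⟩
  𝟙 (P? (f 0)) + length (filter P? (applyUpTo (f ∘ suc) n))   ≡⟨ cong (𝟙 (P? (f 0)) +_) (length-filter-applyUpTo P? (f ∘ suc) n) ⟩
  𝟙 (P? (f 0)) + ∑[ i < n ] 𝟙 (P? (f (suc i)))               ≡⟨ ∑-suc (λ i → 𝟙 (P? (f i))) n ⟨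
  ∑[ i < suc n ] 𝟙 (P? (f i))                                 ∎
  where
  length-filter-∷ : ∀ x xs → length (filter P? (x ∷ xs)) ≡ 𝟙 (P? x) + length (filter P? xs)
  length-filter-∷ x xs with does (P? x)
  ... | true  = refl
  ... | false = refl

m<n+n⇒m≡m%n+n*[n≤m] : ∀ {m n} .{{_ : NonZero n}} → m < n + n → m ≡ m % n + n * 𝟙 (n ≤? m)
m<n+n⇒m≡m%n+n*[n≤m] {m} {n} m<2n = split (n ≤? m)
  where
  split : (n≤?m : Dec (n ≤ m)) → m ≡ m % n + n * 𝟙 n≤?m
  split (yes n≤m) = begin
    m                  ≡⟨ m∸n+n≡m n≤m ⟨
    (m ∸ n) + n        ≡⟨ cong (_+ n) (m<n⇒m%n≡m (m<n+o⇒m∸n<o m n m<2n)) ⟨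
    (m ∸ n) % n + n    ≡⟨ cong₂ _+_ (m≤n⇒[n∸m]%m≡n%m n≤m) (sym (*-identityʳ n)) ⟩
    m % n + n * 1      ∎
  split (no n≰m) = begin
    m                  ≡⟨ m<n⇒m%n≡m (≰⇒> n≰m) ⟨
    m % n              ≡⟨ +-identityʳ (m % n) ⟨
    m % n + 0          ≡⟨ cong (m % n +_) (*-zeroʳ n) ⟨
    m % n + n * 0      ∎

%-+-carry : ∀ a b d .{{_ : NonZero d}} → a % d + b % d ≡ (a + b) % d + d * 𝟙 (d ≤? a % d + b % d)
%-+-carry a b d = trans (m<n+n⇒m≡m%n+n*[n≤m] (+-mono-< (m%n<n a d) (m%n<n b d)))
                        (cong (_+ d * 𝟙 (d ≤? a % d + b % d)) (sym (%-distribˡ-+ a b d)))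

neg-%ℕ : ∀ {s d} .{{_ : NonZero d}} → s ≤ d → (ℤ.- ℤ.+ s) %ℕ d ≡ (d ∸ s) % d
neg-%ℕ {zero}  {d@(suc _)} _ = sym (n%n≡0 d)
neg-%ℕ {suc k} {d} s≤d with m≤n⇒m<n∨m≡n s≤d
... | inj₂ refl with suc k % suc k | n%n≡0 (suc k)
...   | .0 | refl = cong (_% suc k) (sym (n∸n≡0 k))
neg-%ℕ {suc k} {d} s≤d | inj₁ s<d with suc k % d | m<n⇒m%n≡m s<d
...   | .(suc k) | refl = sym (m<n⇒m%n≡m (∸-monoʳ-< z<s s≤d))

⊖-%ℕ : ∀ a b {c d} .{{_ : NonZero d}} → b + c ≡ d → (a ⊖ b) %ℕ d ≡ (a + c) % d
⊖-%ℕ a b {c} {d} b+c≡d with b ≤? a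
... | yes b≤a = begin
  (a ⊖ b) %ℕ d        ≡⟨ cong (_%ℕ d) (⊖-≥ b≤a) ⟩
  (a ∸ b) % d         ≡⟨ [m+n]%n≡m%n (a ∸ b) d ⟨
  ((a ∸ b) + d) % d   ≡⟨ cong (λ x → ((a ∸ b) + x) % d) b+c≡d ⟨
  ((a ∸ b) + (b + c)) % d ≡⟨ cong (_% d) (+-assoc (a ∸ b) b c) ⟨
  ((a ∸ b) + b + c) % d   ≡⟨ cong (λ x → (x + c) % d) (m∸n+n≡m b≤a) ⟩
  (a + c) % d         ∎
... | no b≰a = begin
  (a ⊖ b) %ℕ d              ≡⟨ cong (_%ℕ d) (⊖-< a<b) ⟩
  (ℤ.- ℤ.+ (b ∸ a)) %ℕ d    ≡⟨ neg-%ℕ (≤-trans (m∸n≤m b a) (subst (b ≤_) b+c≡d (m≤m+n b c))) ⟩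
  (d ∸ (b ∸ a)) % d         ≡⟨ cong (λ x → (x ∸ (b ∸ a)) % d) d≡a+c+[b∸a] ⟩
  ((a + c) + (b ∸ a) ∸ (b ∸ a)) % d ≡⟨ cong (_% d) (m+n∸n≡m (a + c) (b ∸ a)) ⟩
  (a + c) % d               ∎
  where
  a<b : a < b
  a<b = ≰⇒> b≰a
  d≡a+c+[b∸a] : d ≡ (a + c) + (b ∸ a)
  d≡a+c+[b∸a] = begin
    d                    ≡⟨ b+c≡d ⟨
    b + c                ≡⟨ cong (_+ c) (m+[n∸m]≡n (<⇒≤ a<b)) ⟨
    (a + (b ∸ a)) + c    ≡⟨ +-assoc a (b ∸ a) c ⟩
    a + ((b ∸ a) + c)    ≡⟨ cong (a +_) (+-comm (b ∸ a) c) ⟩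
    a + (c + (b ∸ a))    ≡⟨ +-assoc a c (b ∸ a) ⟨
    (a + c) + (b ∸ a)    ∎

^-odd : ∀ x k → x ^ suc (2 * k) ≡ x * (x * x) ^ k
^-odd x k = cong (x *_) (begin
  x ^ (2 * k)         ≡⟨ ^-*-assoc x 2 k ⟨
  (x * (x * 1)) ^ k   ≡⟨ cong (λ y → (x * y) ^ k) (*-identityʳ x) ⟩
  (x * x) ^ k         ∎)

C-absorption : ∀ n k → suc k * (suc n C suc k) ≡ suc n * (n C k)
C-absorption zero    zero    = refl
C-absorption zero    (suc k) = *-zeroʳ (suc (suc k))
C-absorption (suc n) zero    = begin
  1 * (suc (suc n) C 1)  ≡⟨ *-identityˡ _ ⟩
  suc (suc n) C 1        ≡⟨ nC1≡n (suc (suc n)) ⟩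
  suc (suc n)            ≡⟨ *-identityʳ (suc (suc n)) ⟨
  suc (suc n) * 1        ∎
C-absorption (suc n) (suc k) = begin
  suc (suc k) * (suc (suc n) C suc (suc k))  ≡⟨ cong (suc (suc k) *_) (nCk+nC[k+1]≡[n+1]C[k+1] (suc n) (suc k)) ⟨
  suc (suc k) * (a + b)                ≡⟨ *-distribˡ-+ (suc (suc k)) a b ⟩
  suc (suc k) * a + suc (suc k) * b    ≡⟨ cong (suc (suc k) * a +_) (C-absorption n (suc k)) ⟩
  (a + suc k * a) + suc n * d          ≡⟨ cong (λ x → (a + x) + suc n * d) (C-absorption n k) ⟩
  (a + suc n * c) + suc n * d          ≡⟨ +-assoc a _ _ ⟩
  a + (suc n * c + suc n * d)          ≡⟨ cong (a +_) (*-distribˡ-+ (suc n) c d) ⟨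
  a + suc n * (c + d)                  ≡⟨ cong (λ x → a + suc n * x) (nCk+nC[k+1]≡[n+1]C[k+1] n k) ⟩
  suc (suc n) * a                      ∎
  where
  a = suc n C suc k
  b = suc n C suc (suc k)
  c = n C k
  d = n C suc k

p∣pCk : ∀ {p k} → Prime p → 0 < k → k < p → p ∣ p C k
p∣pCk {suc q} {suc i} p-prime _ k<p
  with euclidsLemma (suc i) (suc q C suc i) p-prime (divides (q C i) (trans (C-absorption q i) (*-comm (suc q) _)))
... | inj₁ p∣k = contradiction p∣k (>⇒∤ k<p)
... | inj₂ p∣C = p∣C

binomial : ∀ a m → suc a ^ m ≡ ∑[ k < suc m ] ((m C k) * a ^ k)
binomial a zero    = refl
binomial a (suc m) = sym (begin
  ∑[ k < suc (suc m) ] f k                                    ≡⟨ ∑-suc f (suc m) ⟩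
  1 + ∑[ k < suc m ] f (suc k)                                ≡⟨ cong (1 +_) (∑-cong (suc m) (λ k _ → pascal k)) ⟩
  1 + ∑[ k < suc m ] (a * g k + g (suc k))                    ≡⟨ cong (1 +_) (∑-+ (λ k → a * g k) (g ∘ suc) (suc m)) ⟩
  1 + (∑[ k < suc m ] (a * g k) + ∑[ k < suc m ] g (suc k))  ≡⟨ cong (λ x → 1 + (x + ∑[ k < suc m ] g (suc k))) (∑-*ˡ a g (suc m)) ⟩
  1 + (a * S + ∑[ k < suc m ] g (suc k))                      ≡⟨ +-swap 1 (a * S) _ ⟩
  a * S + (1 + ∑[ k < suc m ] g (suc k))                      ≡⟨ cong (a * S +_) (∑-suc g (suc m)) ⟨
  a * S + (S + g (suc m))                                     ≡⟨ cong (λ x → a * S + (S + x * a ^ suc m)) (k>n⇒nCk≡0 (n<1+n m)) ⟩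
  a * S + (S + 0)                                             ≡⟨ cong (a * S +_) (+-identityʳ S) ⟩
  a * S + S                                                   ≡⟨ +-comm (a * S) S ⟩
  S + a * S                                                   ≡⟨ cong (λ x → x + a * x) (binomial a m) ⟨
  suc a ^ suc m                                               ∎)
  where
  f g : ℕ → ℕ
  f k = (suc m C k) * a ^ k
  g k = (m C k) * a ^ k
  S = ∑< (suc m) g
  pascal : ∀ k → f (suc k) ≡ a * g k + g (suc k)
  pascal k = begin
    (suc m C suc k) * a ^ suc k                       ≡⟨ cong (_* a ^ suc k) (nCk+nC[k+1]≡[n+1]C[k+1] m k) ⟨
    (m C k + m C suc k) * a ^ suc k                   ≡⟨ *-distribʳ-+ (a ^ suc k) (m C k) (m C suc k) ⟩
    (m C k) * (a * a ^ k) + g (suc k)                 ≡⟨ cong (_+ g (suc k)) (*-swap (m C k) a (a ^ k)) ⟩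
    a * g k + g (suc k)                               ∎

freshmans-dream : ∀ {p} .{{_ : NonZero p}} → Prime p → ∀ a → suc a ^ p % p ≡ (1 + a ^ p) % p
freshmans-dream {p@(suc q)} p-prime a = begin
  suc a ^ p % p                              ≡⟨ cong (_% p) (binomial a p) ⟩
  (∑< p f + f p) % p                         ≡⟨ cong (λ x → (x + f p) % p) (∑-suc f q) ⟩
  ((1 + M) + f p) % p                        ≡⟨ cong (λ x → ((1 + M) + x) % p) fp≡a^p ⟩
  ((1 + M) + a ^ p) % p                      ≡⟨ cong (_% p) (trans (+-assoc 1 M (a ^ p)) (+-swap 1 M (a ^ p))) ⟩
  (M + (1 + a ^ p)) % p                      ≡⟨ %-remove-+ˡ (1 + a ^ p) p∣M ⟩
  (1 + a ^ p) % p                            ∎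
  where
  f : ℕ → ℕ
  f k = (p C k) * a ^ k
  M = ∑[ k < q ] f (suc k)
  p∣M : p ∣ M
  p∣M = ∑-∣ q (λ k k<q → ∣m⇒∣m*n (a ^ suc k) (p∣pCk p-prime (s≤s z≤n) (s≤s k<q)))
  fp≡a^p : f p ≡ a ^ p
  fp≡a^p = trans (cong (_* a ^ p) (nCn≡1 p)) (*-identityˡ (a ^ p))

fermat : ∀ {p} .{{_ : NonZero p}} → Prime p → ∀ a → a ^ p % p ≡ a % p
fermat {suc _}     p-prime zero    = refl
fermat {p@(suc _)} p-prime (suc a) = trans (freshmans-dream p-prime a) (%-cong-+ {1} {1} {a ^ p} {a} refl (fermat p-prime a))

square≢-1-mod-4e+3 : ∀ e → Prime (3 + 4 * e) → ∀ y → y * y % (3 + 4 * e) ≢ 2 + 4 * e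
square≢-1-mod-4e+3 e p-prime y y²≡-1 = contradiction (trans (sym y²≡-1) y²≡0) λ ()
  where
  p q c : ℕ
  p = 3 + 4 * e
  q = 2 + 4 * e
  c = suc (2 * e)

  q%p≡q : q % p ≡ q
  q%p≡q = m<n⇒m%n≡m (n<1+n q)

  q²≡1 : q * q % p ≡ 1 % p
  q²≡1 = trans (cong (_% p) (q² e)) ([m+kn]%n≡m%n 1 (1 + 4 * e) p)
    where
    q² : ∀ e → (2 + 4 * e) * (2 + 4 * e) ≡ 1 + (1 + 4 * e) * (3 + 4 * e)
    q² = solve-∀

  y≡yq : y % p ≡ y * q % p
  y≡yq = begin
    y % p                      ≡⟨ fermat p-prime y ⟨
    y ^ p % p                  ≡⟨ cong (λ k → y ^ k % p) (p≡1+2c e) ⟩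
    y ^ suc (2 * c) % p        ≡⟨ cong (_% p) (^-odd y c) ⟩
    y * (y * y) ^ c % p        ≡⟨ %-cong-* {y} {y} {(y * y) ^ c} {q ^ c} refl (%-cong-^ {y * y} {q} c (trans y²≡-1 (sym q%p≡q))) ⟩
    y * q ^ c % p              ≡⟨ cong (λ x → y * x % p) (^-odd q e) ⟩
    y * (q * (q * q) ^ e) % p  ≡⟨ %-cong-* {y} {y} refl (%-cong-* {q} {q} {(q * q) ^ e} {1 ^ e} refl (%-cong-^ {q * q} {1} e q²≡1)) ⟩
    y * (q * 1 ^ e) % p        ≡⟨ cong (λ x → y * (q * x) % p) (^-zeroˡ e) ⟩
    y * (q * 1) % p            ≡⟨ cong (λ x → y * x % p) (*-identityʳ q) ⟩
    y * q % p                  ∎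
    where
    p≡1+2c : ∀ e → 3 + 4 * e ≡ suc (2 * suc (2 * e))
    p≡1+2c = solve-∀

  p∣2y : p ∣ 2 * y
  p∣2y = m%n≡0⇒n∣m (2 * y) p (begin
    (y + (y + 0)) % p  ≡⟨ cong (λ x → (y + x) % p) (+-identityʳ y) ⟩
    (y + y) % p        ≡⟨ %-cong-+ {y} {y} {y} {y * q} refl y≡yq ⟩
    (y + y * q) % p    ≡⟨ cong (_% p) (*-suc y q) ⟨
    (y * p) % p        ≡⟨ m*n%n≡0 y p ⟩
    0                  ∎)

  y²≡0 : y * y % p ≡ 0
  y²≡0 = [ (λ p∣2 → contradiction p∣2 (>⇒∤ (s≤s (s≤s (s≤s z≤n)))))
         , (λ p∣y → n∣m⇒m%n≡0 (y * y) p (∣m⇒∣m*n y p∣y))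
         ]′ (euclidsLemma 2 y p-prime p∣2y)

4[1+m]∸1≡3+4m : ∀ m → 4 * suc m ∸ 1 ≡ 3 + 4 * m
4[1+m]∸1≡3+4m m = cong (_∸ 1) (*-suc 4 m)

module _ (m : ℕ) (p-prime : Prime (3 + 4 * m)) where
  private
    p q n : ℕ
    p = 3 + 4 * m
    q = 2 + 4 * m
    n = suc m

  Γ[2+i] : ∀ i → Γ p n (ℤ.+ (2 + i)) ≡ suc i * suc i % p + (suc i + suc n) % p
  Γ[2+i] i = cong (suc i * suc i % p +_) (begin
    (ℤ.+ (2 + i + 1) ℤ.- ℤ.+ (3 * n)) %ℕ p  ≡⟨ cong (_%ℕ p) ([+m]-[+n]≡m⊖n (2 + i + 1) (3 * n)) ⟩
    ((2 + i + 1) ⊖ 3 * n) %ℕ p              ≡⟨ ⊖-%ℕ (2 + i + 1) (3 * n) (3n+m≡p m) ⟩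
    (2 + i + 1 + m) % p                     ≡⟨ cong (_% p) (reorder i m) ⟩
    (suc i + suc n) % p                     ∎)
    where
    3n+m≡p : ∀ m → 3 * suc m + m ≡ 3 + 4 * m
    3n+m≡p = solve-∀
    reorder : ∀ i m → 2 + i + 1 + m ≡ suc i + suc (suc m)
    reorder = solve-∀

  jump : ℕ → ℕ
  jump j = 𝟙 (p ≤? j * j % p + (j + suc n) % p)

  one-plus-square : ∀ y → (1 + y * y) % p ≡ 1 + y * y % p
  one-plus-square y = begin
    (1 + y * y) % p          ≡⟨ %-distribˡ-+ 1 (y * y) p ⟩
    (1 + y * y % p) % p      ≡⟨ m<n⇒m%n≡m (s≤s (≤∧≢⇒< (s≤s⁻¹ (m%n<n (y * y) p)) (square≢-1-mod-4e+3 m p-prime y))) ⟩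
    1 + y * y % p            ∎

  complete-square : ∀ j → (j * j + (j + suc n)) % p ≡ (1 + (j + 2 * n) * (j + 2 * n)) % p
  complete-square j = sym (trans (cong (_% p) (square-identity j m)) ([m+kn]%n≡m%n (j * j + (j + suc n)) (j + n) p))
    where
    square-identity : ∀ j m → 1 + (j + 2 * suc m) * (j + 2 * suc m) ≡ (j * j + (j + suc (suc m))) + (j + suc m) * (3 + 4 * m)
    square-identity = solve-∀

  ∑-[j²+j+n+1]%p : ∑[ j < p ] ((j * j + (j + suc n)) % p) ≡ p + ∑[ y < p ] (y * y % p)
  ∑-[j²+j+n+1]%p = begin
    ∑[ j < p ] ((j * j + (j + suc n)) % p)           ≡⟨ ∑-cong p (λ j _ → complete-square j) ⟩
    ∑[ j < p ] ((1 + (j + 2 * n) * (j + 2 * n)) % p) ≡⟨ ∑-cong p (λ j _ → reduce-base (j + 2 * n)) ⟩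
    ∑[ j < p ] g ((j + 2 * n) % p)                   ≡⟨ ∑-rotate p g (2 * n) ⟩
    ∑[ y < p ] g y                                   ≡⟨ ∑-cong p (λ y _ → one-plus-square y) ⟩
    ∑[ y < p ] (1 + y * y % p)                       ≡⟨ ∑-+ (λ _ → 1) (λ y → y * y % p) p ⟩
    ∑[ y < p ] 1 + ∑[ y < p ] (y * y % p)            ≡⟨ cong (_+ ∑[ y < p ] (y * y % p)) (∑-1 p) ⟩
    p + ∑[ y < p ] (y * y % p)                       ∎
    where
    g : ℕ → ℕ
    g y = (1 + y * y) % p
    reduce-base : ∀ x → (1 + x * x) % p ≡ g (x % p)
    reduce-base x = %-cong-+ {1} {1} {x * x} {x % p * (x % p)} refl (%-distribˡ-* x x p)

  ∑-id≡p*[1+∑-jump] : ∑[ j < p ] j ≡ p * suc (∑< p jump)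
  ∑-id≡p*[1+∑-jump] = +-cancelˡ-≡ R _ _ (begin
    R + ∑[ j < p ] j                                  ≡⟨ cong (R +_) (∑-rotate p (λ x → x) (suc n)) ⟨
    R + ∑[ j < p ] ((j + suc n) % p)                  ≡⟨ ∑-+ (λ j → j * j % p) (λ j → (j + suc n) % p) p ⟨
    ∑[ j < p ] (j * j % p + (j + suc n) % p)          ≡⟨ ∑-cong p (λ j _ → %-+-carry (j * j) (j + suc n) p) ⟩
    ∑[ j < p ] ((j * j + (j + suc n)) % p + p * jump j) ≡⟨ ∑-+ (λ j → (j * j + (j + suc n)) % p) (λ j → p * jump j) p ⟩
    ∑[ j < p ] ((j * j + (j + suc n)) % p) + ∑[ j < p ] (p * jump j) ≡⟨ cong₂ _+_ ∑-[j²+j+n+1]%p (∑-*ˡ p jump p) ⟩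
    (p + R) + p * ∑< p jump                           ≡⟨ cong (_+ p * ∑< p jump) (+-comm p R) ⟩
    (R + p) + p * ∑< p jump                           ≡⟨ +-assoc R p _ ⟩
    R + (p + p * ∑< p jump)                           ≡⟨ cong (R +_) (*-suc p (∑< p jump)) ⟨
    R + p * suc (∑< p jump)                           ∎)
    where
    R = ∑[ y < p ] (y * y % p)

  ∑-jump≡2m : ∑< p jump ≡ 2 * m
  ∑-jump≡2m = suc-injective (*-cancelˡ-≡ _ _ 2 (*-cancelˡ-≡ _ _ p (begin
    p * (2 * suc J)          ≡⟨ *-swap p 2 (suc J) ⟩
    2 * (p * suc J)          ≡⟨ cong (2 *_) ∑-id≡p*[1+∑-jump] ⟨
    2 * ∑[ j < p ] j         ≡⟨ 2*∑-id q ⟩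
    p * q                    ≡⟨ cong (p *_) (q≡2*[1+2m] m) ⟩
    p * (2 * suc (2 * m))    ∎)))
    where
    J = ∑< p jump
    q≡2*[1+2m] : ∀ m → 2 + 4 * m ≡ 2 * suc (2 * m)
    q≡2*[1+2m] = solve-∀

  jumpCount≡2m : jumpCount p n ≡ 2 * m
  jumpCount≡2m = begin
    jumpCount p n                                     ≡⟨ cong (length ∘ filter Q) (map-upTo (2 +_) (suc (4 * n ∸ 1) ∸ 2)) ⟩
    length (filter Q (applyUpTo (2 +_) (suc (4 * n ∸ 1) ∸ 2))) ≡⟨ length-filter-applyUpTo Q (2 +_) (suc (4 * n ∸ 1) ∸ 2) ⟩
    ∑[ i < suc (4 * n ∸ 1) ∸ 2 ] 𝟙 (Q (2 + i))        ≡⟨ cong (λ k → ∑[ i < suc k ∸ 2 ] 𝟙 (Q (2 + i))) (4[1+m]∸1≡3+4m m) ⟩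
    ∑[ i < q ] 𝟙 (Q (2 + i))                          ≡⟨ ∑-cong q (λ i _ → cong (λ x → 𝟙 (p ≤? x)) (Γ[2+i] i)) ⟩
    ∑[ i < q ] jump (suc i)                           ≡⟨ cong (_+ ∑[ i < q ] jump (suc i)) jump-0 ⟨
    jump 0 + ∑[ i < q ] jump (suc i)                  ≡⟨ ∑-suc jump q ⟨
    ∑< p jump                                         ≡⟨ ∑-jump≡2m ⟩
    2 * m                                             ∎
    where
    Q : ∀ k → Dec (p ≤ Γ p n (ℤ.+ k))
    Q k = p ≤? Γ p n (ℤ.+ k)
    jump-0 : jump 0 ≡ 0
    jump-0 = 𝟙-false (p ≤? _) (<⇒≱ (m%n<n (suc n) p))

-- The hypothesis n > 3 only excludes n = 0: the count is 2n − 2 whenever 4n − 1 is prime.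
theorem4p6 : (n p : ℕ) .{{_ : NonZero p}} → 3 < n → p ≡ 4 * n ∸ 1 → Prime p →
    jumpCount p n ≡ 2 * n ∸ 2
theorem4p6 zero    p () _ _
theorem4p6 (suc m) p _ p≡4n-1 p-prime with trans p≡4n-1 (4[1+m]∸1≡3+4m m)
... | refl = trans (jumpCount≡2m m p-prime) (sym (cong (_∸ 2) (*-suc 2 m)))
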